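{- Let $G$ be a finite graph and $u\in V(G)$ a cut vertex of $G$. Then $G$ is a leaf power if and only if for every connected component $C$ of $G-u$, the induced subgraph $G[V(C)\cup\{u\}]$ is a leaf power.
   Context: A graph $G$ is a leaf power if there exist a tree $T$ whose set of leaves is exactly $V(G)$ and a weighting $\mathsf{w}:E(T)\to[0,1]\cap\mathbb{Q}$ such that for distinct $x,y\in V(G)$, $xy\in E(G)$ iff the sum of the weights on the unique $x$–$y$ path of $T$ is at most $1$. A cut vertex is a vertex whose removal increases the number of connected components. -}

module Defs where

open import Data.Nat using (ℕ; zero; suc; _<_; _≤_)
open import Data.Fin using (Fin; toℕ)
open import Data.List using (List; []; _∷_; length)
open import Data.List.Relation.Unary.All using (All)
open import Data.List.Relation.Unary.Unique.Propositional using (Unique)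
open import Data.List.Membership.Propositional using (_∈_)
open import Data.Product using (Σ; ∃; _×_; _,_; proj₁)
open import Data.Sum using (_⊎_)
open import Data.Unit using (⊤)
open import Data.Rational using (ℚ; 0ℚ; 1ℚ; _+_) renaming (_≤_ to _≤ℚ_)
open import Function.Bundles using (_⇔_)
open import Relation.Binary.PropositionalEquality using (_≡_; _≢_)
open import Relation.Nullary using (¬_)

record Graph (V : Set) : Set₁ where
  field
    Adj   : V → V → Set
    sym   : ∀ {x y} → Adj x y → Adj y x
    irrefl : ∀ {x} → ¬ Adj x x
open Graph public

data Walk {V : Set} (G : Graph V) : V → V → Set where
  nil  : (x : V) → Walk G x x
  cons : ∀ {x y z} → Adj G x y → Walk G y z → Walk G x z

verts : ∀ {V} {G : Graph V} {x y} → Walk G x y → List V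
verts (nil x) = x ∷ []
verts (cons {x = x} _ p) = x ∷ verts p

walkLength : ∀ {V} {G : Graph V} {x y} → Walk G x y → ℕ
walkLength (nil _) = 0
walkLength (cons _ p) = suc (walkLength p)

IsPath : ∀ {V} {G : Graph V} {x y} → Walk G x y → Set
IsPath p = Unique (verts p)

weight : ∀ {V} {G : Graph V} → (V → V → ℚ) → ∀ {x y} → Walk G x y → ℚ
weight w (nil _) = 0ℚ
weight w (cons {x = x} {y = y} _ p) = w x y + weight w p

Connected : ∀ {V} → Graph V → Set
Connected G = ∀ x y → Walk G x y

HasCycle : ∀ {V} → Graph V → Set
HasCycle {V} G =
  Σ V λ x → Σ V λ y → Σ (Walk G x y) λ p → IsPath p × (2 ≤ walkLength p) × Adj G y x

IsTree : ∀ {V} → Graph V → Set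
IsTree G = Connected G × ¬ HasCycle G

-- a leaf of a tree: a vertex with at most one neighbour
-- (degree 1 when the tree has ≥ 2 vertices; the one-vertex tree is its own leaf)
IsLeaf : ∀ {V} → Graph V → V → Set
IsLeaf G v = ∀ a b → Adj G v a → Adj G v b → a ≡ b

-- LeafPowerIn G S : the induced subgraph G[S] is a leaf power.
-- (Subsets S may be proof-relevant predicates, so G[S] is not formed as a
-- graph on Σ (Fin n) S, which could duplicate vertices; instead the leaf map
-- ι is a function on Fin n whose values matter only on S.)

LeafPowerIn : ∀ {n} → Graph (Fin n) → (Fin n → Set) → Set₁
LeafPowerIn {n} G S =
  Σ ℕ λ m → Σ (Graph (Fin m)) λ T → IsTree T ×
  Σ (Fin n → Fin m) λ ι → (∀ x y → S x → S y → ι x ≡ ι y → x ≡ y) ×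
    (∀ x → S x → IsLeaf T (ι x)) × (∀ t → IsLeaf T t → Σ (Fin n) λ x → S x × ι x ≡ t) ×
  Σ (Fin m → Fin m → ℚ) λ w → (∀ a b → w a b ≡ w b a) ×
    (∀ a b → Adj T a b → (0ℚ ≤ℚ w a b) × (w a b ≤ℚ 1ℚ)) ×
    (∀ x y → S x → S y → x ≢ y →
      Adj G x y ⇔ (Σ (Walk T (ι x) (ι y)) λ p → IsPath p × (weight w p ≤ℚ 1ℚ)))

LeafPower : ∀ {n} → Graph (Fin n) → Set₁
LeafPower G = LeafPowerIn G (λ _ → ⊤)

ReachIn : ∀ {n} → Graph (Fin n) → (Fin n → Set) → Fin n → Fin n → Set
ReachIn G S x y = Σ (Walk G x y) λ p → All S (verts p)

-- the number of connected components of G[S] is k: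
-- we count the components via their representatives, the vertex of least index
NumComponentsIn : ∀ {n} → Graph (Fin n) → (Fin n → Set) → ℕ → Set
NumComponentsIn {n} G S k =
  Σ (List (Fin n)) λ l → Unique l × length l ≡ k ×
    (∀ v → (v ∈ l) ⇔ (S v × (∀ w → ReachIn G S v w → toℕ v ≤ toℕ w)))

IsCutVertex : ∀ {n} → Graph (Fin n) → Fin n → Set
IsCutVertex G u = Σ ℕ λ k → Σ ℕ λ k' →
  NumComponentsIn G (λ _ → ⊤) k × NumComponentsIn G (λ v → v ≢ u) k' × k < k'

CompPlus : ∀ {n} → Graph (Fin n) → (u c : Fin n) → Fin n → Set
CompPlus G u c v = v ≡ u ⊎ ReachIn G (λ x → x ≢ u) c v

-- A leaf root of G restricts to a leaf root of each block G[V(C) ∪ {u}] once the leaves outside the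
-- block are pruned. Conversely, the blocks share only u and no edge of G joins two components of G - u,
-- so leaf roots of the blocks can be glued one block at a time: rescale both so that every path between
-- labelled leaves weighs at least 2/3, join the two trees at the leaves of u, and give u a fresh leaf.
-- A path through the junction then weighs more than 1, so vertices of different blocks stay non-adjacent.
module Submission where

open import Defs
open import Data.Empty using (⊥; ⊥-elim)
open import Data.Fin as Fin using (Fin)
import Data.Fin.Properties as Finₚ
import Data.Integer as ℤ
open import Data.List as List using (List; []; _∷_; _∷ʳ_; map; length; lookup; allFin)
open import Data.List.Membership.Propositional using (_∈_; _∉_)
open import Data.List.Membership.Propositional.Properties using (∈-++⁻; ∈-map⁻; ∈-lookup; ∈-allFin)
open import Data.List.Relation.Unary.All as All using (All; []; _∷_)
open import Data.List.Relation.Unary.All.Properties using (All¬⇒¬Any; ¬Any⇒All¬; ++⁻ˡ)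
open import Data.List.Relation.Unary.AllPairs using ([]; _∷_)
open import Data.List.Relation.Unary.Any using (here; there)
open import Data.List.Relation.Unary.Unique.Propositional using (Unique)
import Data.List.Relation.Unary.Unique.Propositional.Properties as Uniqueₚ
open import Data.Nat as ℕ using (ℕ; zero; suc; s≤s; z≤n)
import Data.Nat.Properties as ℕₚ
open import Data.Product using (Σ; _×_; _,_; proj₁; proj₂)
open import Data.Rational as ℚ using (ℚ; 0ℚ; 1ℚ; _+_; _*_; _≤_; _<_)
import Data.Rational.Properties as ℚₚ
open import Data.Rational.Solver using (module +-*-Solver)
open import Data.Sum as Sum using (_⊎_; inj₁; inj₂; [_,_]′)
open import Data.Sum.Properties using (inj₁-injective; inj₂-injective)
open import Data.Unit using (⊤; tt)
open import Function.Bundles using (_⇔_; mk⇔; Equivalence; _↔_; Inverse; Injection)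
open import Function.Properties.Inverse using (↔⇒↣)
import Function.Properties.Equivalence as ⇔
open import Function.Construct.Composition using (_↔-∘_)
open import Function.Construct.Identity using (↔-id)
open import Data.Sum.Function.Propositional using (_⊎-↔_)
open import Relation.Binary.Definitions using (DecidableEquality)
open import Relation.Binary.PropositionalEquality as ≡ using (_≡_; _≢_; refl; cong; cong₂; subst)
open import Relation.Nullary using (¬_; Dec; yes; no)
open import Relation.Nullary.Decidable using (toWitness; map′; _×-dec_; _⊎-dec_; _→-dec_; ¬?)

open Equivalence using (to; from)

lookup-injective : ∀ {A : Set} {xs : List A} → Unique xs →
  ∀ {i j} → lookup xs i ≡ lookup xs j → i ≡ j
lookup-injective (_ ∷ _) {Fin.zero} {Fin.zero} _ = refl
lookup-injective (x∉ ∷ _) {Fin.zero} {Fin.suc j} eq = ⊥-elim (All.lookup x∉ (∈-lookup j) eq)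
lookup-injective (x∉ ∷ _) {Fin.suc i} {Fin.zero} eq = ⊥-elim (All.lookup x∉ (∈-lookup i) (≡.sym eq))
lookup-injective (_ ∷ u) {Fin.suc i} {Fin.suc j} eq = cong Fin.suc (lookup-injective u eq)

Unique⇒length≤ : ∀ {n} {xs : List (Fin n)} → Unique xs → length xs ℕ.≤ n
Unique⇒length≤ {n} {xs} u with length xs ℕ.≤? n
... | yes ≤n = ≤n
... | no ≰n with Finₚ.pigeonhole (ℕₚ.≰⇒> ≰n) (lookup xs)
...   | i , j , i<j , eq = ⊥-elim (Finₚ.<⇒≢ i<j (lookup-injective u eq))

Unique-++⁻ : ∀ {A : Set} (xs : List A) {ys} → Unique (xs List.++ ys) → Unique xs × Unique ys
Unique-++⁻ []       u         = [] , u
Unique-++⁻ (x ∷ xs) (x∉ ∷ u) = (++⁻ˡ xs x∉ ∷ proj₁ (Unique-++⁻ xs u)) , proj₂ (Unique-++⁻ xs u)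

⅓ : ℚ
⅓ = ℤ.+ 1 ℚ./ 3

avg₃ : ℚ → ℚ → ℚ → ℚ
avg₃ x y z = (x + (y + z)) * ⅓

⅔ : ℚ
⅔ = avg₃ 0ℚ 1ℚ 1ℚ

avg₃-mono-≤ : ∀ {x x′ y y′ z z′} → x ≤ x′ → y ≤ y′ → z ≤ z′ → avg₃ x y z ≤ avg₃ x′ y′ z′
avg₃-mono-≤ x≤ y≤ z≤ = ℚₚ.*-monoʳ-≤-nonNeg ⅓ (ℚₚ.+-mono-≤ x≤ (ℚₚ.+-mono-≤ y≤ z≤))

avg₃-≤1 : ∀ {x} → x ≤ 1ℚ ⇔ avg₃ x 1ℚ 1ℚ ≤ 1ℚ
avg₃-≤1 {x} = mk⇔ (λ x≤1 → avg₃-mono-≤ {y′ = 1ℚ} {z′ = 1ℚ} x≤1 ℚₚ.≤-refl ℚₚ.≤-refl) from′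
  where
  open +-*-Solver
  avg₃-cancel : ∀ y → (y + (1ℚ + 1ℚ)) * ⅓ * (ℤ.+ 3 ℚ./ 1) + (ℚ.- (1ℚ + 1ℚ)) ≡ y
  avg₃-cancel = solve 1 (λ y → (y :+ (con 1ℚ :+ con 1ℚ)) :* con ⅓ :* con (ℤ.+ 3 ℚ./ 1) :+ (:- (con 1ℚ :+ con 1ℚ))
                              := y) refl
  from′ : avg₃ x 1ℚ 1ℚ ≤ 1ℚ → x ≤ 1ℚ
  from′ h = subst (_≤ 1ℚ) (avg₃-cancel x)
    (ℚₚ.+-monoˡ-≤ (ℚ.- (1ℚ + 1ℚ)) (ℚₚ.*-monoʳ-≤-nonNeg (ℤ.+ 3 ℚ./ 1) h))

1<⅔+⅔ : 1ℚ < ⅔ + ⅔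
1<⅔+⅔ = toWitness {a? = 1ℚ ℚ.<? (⅔ + ⅔)} _

module _ {V : Set} {G : Graph V} where

  _++ʷ_ : ∀ {x y z} → Walk G x y → Walk G y z → Walk G x z
  nil _    ++ʷ q = q
  cons e p ++ʷ q = cons e (p ++ʷ q)

  _∷ʳʷ_ : ∀ {x y z} → Walk G x y → Adj G y z → Walk G x z
  nil _     ∷ʳʷ e = cons e (nil _)
  cons e′ p ∷ʳʷ e = cons e′ (p ∷ʳʷ e)

  reverseʷ : ∀ {x y} → Walk G x y → Walk G y x
  reverseʷ (nil x)    = nil x
  reverseʷ (cons e p) = reverseʷ p ∷ʳʷ sym G e

  head∈verts : ∀ {x y} (p : Walk G x y) → x ∈ verts p
  head∈verts (nil _)    = here refl
  head∈verts (cons _ _) = here refl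

  last∈verts : ∀ {x y} (p : Walk G x y) → y ∈ verts p
  last∈verts (nil _)    = here refl
  last∈verts (cons _ p) = there (last∈verts p)

  ∈-verts-++ʷ⁻ : ∀ {x y z v} (p : Walk G x y) (q : Walk G y z) →
    v ∈ verts (p ++ʷ q) → v ∈ verts p ⊎ v ∈ verts q
  ∈-verts-++ʷ⁻ (nil _)    q v∈          = inj₂ v∈
  ∈-verts-++ʷ⁻ (cons e p) q (here v≡)   = inj₁ (here v≡)
  ∈-verts-++ʷ⁻ (cons e p) q (there v∈) = Sum.map₁ there (∈-verts-++ʷ⁻ p q v∈)

  verts-∷ʳʷ : ∀ {x y z} (p : Walk G x y) (e : Adj G y z) → verts (p ∷ʳʷ e) ≡ verts p ∷ʳ z
  verts-∷ʳʷ (nil _)     e = refl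
  verts-∷ʳʷ (cons e′ p) e = cong (_ ∷_) (verts-∷ʳʷ p e)

  walkLength-∷ʳʷ : ∀ {x y z} (p : Walk G x y) (e : Adj G y z) →
    walkLength (p ∷ʳʷ e) ≡ suc (walkLength p)
  walkLength-∷ʳʷ (nil _)     e = refl
  walkLength-∷ʳʷ (cons e′ p) e = cong suc (walkLength-∷ʳʷ p e)

  ∈-verts-reverseʷ⁻ : ∀ {x y v} (p : Walk G x y) → v ∈ verts (reverseʷ p) → v ∈ verts p
  ∈-verts-reverseʷ⁻ (nil _) v∈ = v∈
  ∈-verts-reverseʷ⁻ (cons e p) v∈ rewrite verts-∷ʳʷ (reverseʷ p) (sym G e)
    with ∈-++⁻ (verts (reverseʷ p)) v∈
  ... | inj₁ v∈′        = there (∈-verts-reverseʷ⁻ p v∈′)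
  ... | inj₂ (here v≡) = here v≡

  reverseʷ-isPath : ∀ {x y} (p : Walk G x y) → IsPath p → IsPath (reverseʷ p)
  reverseʷ-isPath (nil _) u = u
  reverseʷ-isPath (cons e p) (x∉ ∷ u) rewrite verts-∷ʳʷ (reverseʷ p) (sym G e) =
    Uniqueₚ.++⁺ (reverseʷ-isPath p u) ([] ∷ [])
      λ { (v∈ , here refl) → All¬⇒¬Any x∉ (∈-verts-reverseʷ⁻ p v∈) }

  walkLength-reverseʷ : ∀ {x y} (p : Walk G x y) → walkLength (reverseʷ p) ≡ walkLength p
  walkLength-reverseʷ (nil _)    = refl
  walkLength-reverseʷ (cons e p) =
    ≡.trans (walkLength-∷ʳʷ (reverseʷ p) (sym G e)) (cong suc (walkLength-reverseʷ p))

  length-verts : ∀ {x y} (p : Walk G x y) → length (verts p) ≡ suc (walkLength p)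
  length-verts (nil _)    = refl
  length-verts (cons _ p) = cong suc (length-verts p)

  closedPath⇒walkLength≡0 : ∀ {x} (p : Walk G x x) → IsPath p → walkLength p ≡ 0
  closedPath⇒walkLength≡0 (nil _)    _       = refl
  closedPath⇒walkLength≡0 (cons e p) (x∉ ∷ _) = ⊥-elim (All¬⇒¬Any x∉ (last∈verts p))

  ≢⇒1≤walkLength : ∀ {x y} → x ≢ y → (p : Walk G x y) → 1 ℕ.≤ walkLength p
  ≢⇒1≤walkLength x≢x (nil _)    = ⊥-elim (x≢x refl)
  ≢⇒1≤walkLength _   (cons _ _) = s≤s z≤n

  first-step : ∀ {x y} → x ≢ y → Walk G x y → Σ V (Adj G x)
  first-step x≢x (nil _)            = ⊥-elim (x≢x refl)
  first-step _   (cons {y = d} e _) = d , e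

  castʷ : ∀ {x x′ y y′} → x ≡ x′ → y ≡ y′ → (p : Walk G x y) →
    Σ (Walk G x′ y′) λ p′ → verts p′ ≡ verts p × (∀ w → weight w p′ ≡ weight w p)
  castʷ refl refl p = p , refl , λ _ → refl

  module _ (w : V → V → ℚ) where

    weight-nonneg : (∀ a b → Adj G a b → 0ℚ ≤ w a b) → ∀ {x y} (p : Walk G x y) → 0ℚ ≤ weight w p
    weight-nonneg _  (nil _)                   = ℚₚ.≤-refl
    weight-nonneg w≥0 (cons {x = a} {y = b} e p) = ℚₚ.+-mono-≤ (w≥0 a b e) (weight-nonneg w≥0 p)

    closedPath⇒weight≡0 : ∀ {x} (p : Walk G x x) → IsPath p → weight w p ≡ 0ℚ
    closedPath⇒weight≡0 (nil _)    _        = refl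
    closedPath⇒weight≡0 (cons e p) (x∉ ∷ _) = ⊥-elim (All¬⇒¬Any x∉ (last∈verts p))

    weight-∷ʳʷ : ∀ {x y z} (p : Walk G x y) (e : Adj G y z) → weight w (p ∷ʳʷ e) ≡ weight w p + w y z
    weight-∷ʳʷ {y = y} {z} (nil _) e = ≡.trans (ℚₚ.+-identityʳ (w y z)) (≡.sym (ℚₚ.+-identityˡ (w y z)))
    weight-∷ʳʷ (cons {x = a} {y = b} e′ p) e =
      ≡.trans (cong (w a b +_) (weight-∷ʳʷ p e)) (≡.sym (ℚₚ.+-assoc (w a b) _ _))

    weight-reverseʷ : (∀ a b → w a b ≡ w b a) → ∀ {x y} (p : Walk G x y) → weight w (reverseʷ p) ≡ weight w p
    weight-reverseʷ w-sym (nil _) = refl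
    weight-reverseʷ w-sym (cons {x = a} {y = b} e p) = begin
      weight w (reverseʷ p ∷ʳʷ sym G e)   ≡⟨ weight-∷ʳʷ (reverseʷ p) (sym G e) ⟩
      weight w (reverseʷ p) + w b a       ≡⟨ cong₂ _+_ (weight-reverseʷ w-sym p) (w-sym b a) ⟩
      weight w p + w a b                  ≡⟨ ℚₚ.+-comm (weight w p) (w a b) ⟩
      w a b + weight w p                  ∎
      where open ≡.≡-Reasoning

module _ {V U : Set} {G : Graph V} {K : Graph U} (h : V → U)
         (h-adj : ∀ {a b} → Adj G a b → Adj K (h a) (h b)) where

  mapʷ : ∀ {x y} → Walk G x y → Walk K (h x) (h y)
  mapʷ (nil x)    = nil (h x)
  mapʷ (cons e p) = cons (h-adj e) (mapʷ p)

  verts-mapʷ : ∀ {x y} (p : Walk G x y) → verts (mapʷ p) ≡ map h (verts p)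
  verts-mapʷ (nil _)    = refl
  verts-mapʷ (cons e p) = cong (_ ∷_) (verts-mapʷ p)

  walkLength-mapʷ : ∀ {x y} (p : Walk G x y) → walkLength (mapʷ p) ≡ walkLength p
  walkLength-mapʷ (nil _)    = refl
  walkLength-mapʷ (cons e p) = cong suc (walkLength-mapʷ p)

  weight-mapʷ : ∀ (w : U → U → ℚ) {x y} (p : Walk G x y) →
    weight w (mapʷ p) ≡ weight (λ a b → w (h a) (h b)) p
  weight-mapʷ w (nil _)    = refl
  weight-mapʷ w (cons {x = a} {y = b} e p) = cong (w (h a) (h b) +_) (weight-mapʷ w p)

  mapʷ-isPath : (∀ {a b} → h a ≡ h b → a ≡ b) → ∀ {x y} (p : Walk G x y) → IsPath p → IsPath (mapʷ p)
  mapʷ-isPath h-inj p u rewrite verts-mapʷ p = Uniqueₚ.map⁺ h-inj u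

  isPath-mapʷ⁻ : ∀ {x y} (p : Walk G x y) → IsPath (mapʷ p) → IsPath p
  isPath-mapʷ⁻ p u = Uniqueₚ.map⁻ (subst Unique (verts-mapʷ p) u)

comap : ∀ {V U : Set} → (U → V) → Graph V → Graph U
comap h G = record { Adj = λ i j → Adj G (h i) (h j) ; sym = sym G ; irrefl = irrefl G }

InImage : ∀ {U V : Set} → (U → V) → V → Set
InImage {U} h v = Σ U λ i → h i ≡ v

module _ {V U : Set} (G : Graph V) (h : U → V) (h-inj : ∀ {i j} → h i ≡ h j → i ≡ j) where

  liftʷ : ∀ {a b} (p : Walk G a b) → All (InImage h) (verts p) → ∀ i j → h i ≡ a → h j ≡ b →
    Σ (Walk (comap h G) i j) λ q → map h (verts q) ≡ verts p ×
      (∀ w → weight (λ i j → w (h i) (h j)) q ≡ weight w p)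
  liftʷ (nil a) _ i j refl hj≡ with h-inj (≡.sym hj≡)
  ... | refl = nil i , refl , λ _ → refl
  liftʷ (cons {y = a′} e p) (_ ∷ p⊆im) i j refl hj≡ with All.lookup p⊆im (head∈verts p)
  ... | i′ , refl with liftʷ p p⊆im i′ j refl hj≡
  ...   | q , verts≡ , weight≡ = cons e q , cong (h i ∷_) verts≡ , λ w → cong (w (h i) a′ +_) (weight≡ w)

  comap-isTree : IsTree G → (∀ i j → Σ (Walk G (h i) (h j)) λ p → All (InImage h) (verts p)) →
    IsTree (comap h G)
  comap-isTree (_ , acyclic) connected =
    (λ i j → let (p , p⊆im) = connected i j in proj₁ (liftʷ p p⊆im i j refl refl)) ,
    λ { (x , y , q , q-path , 2≤len , yx) → acyclic (h x , h y , mapʷ h (λ e → e) q ,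
          mapʷ-isPath h (λ e → e) h-inj q q-path ,
          subst (2 ℕ.≤_) (≡.sym (walkLength-mapʷ h (λ e → e) q)) 2≤len , yx) }

path-interior-not-leaf : ∀ {V} {G : Graph V} {a b c d} (e : Adj G a b) (e′ : Adj G b c) (p : Walk G c d) →
  IsPath (cons e (cons e′ p)) → ¬ IsLeaf G b
path-interior-not-leaf {G = G} e e′ p ((_ ∷ b∉) ∷ _) b-leaf =
  All.lookup b∉ (head∈verts p) (b-leaf _ _ (sym G e) e′)

leaf-avoided-by-path : ∀ {V} {G : Graph V} {t} → IsLeaf G t → ∀ {a b} (p : Walk G a b) → IsPath p →
  t ≢ a → t ≢ b → All (_≢ t) (verts p)
leaf-avoided-by-path t-leaf (nil a) _ t≢a _ = (λ a≡t → t≢a (≡.sym a≡t)) ∷ []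
leaf-avoided-by-path t-leaf (cons e (nil _)) _ t≢a t≢b = (λ a≡t → t≢a (≡.sym a≡t)) ∷ (λ b≡t → t≢b (≡.sym b≡t)) ∷ []
leaf-avoided-by-path t-leaf (cons e (cons e′ p)) (a∉ ∷ u) t≢a t≢b =
  (λ a≡t → t≢a (≡.sym a≡t)) ∷
  leaf-avoided-by-path t-leaf (cons e′ p) u (λ { refl → path-interior-not-leaf e e′ p (a∉ ∷ u) t-leaf }) t≢b

module _ {V : Set} {G : Graph V} (_≟_ : DecidableEquality V) where
  open import Data.List.Membership.DecPropositional _≟_ using (_∈?_)

  dropUntil : ∀ {x y z} (q : Walk G y z) → x ∈ verts q →
    Σ (Walk G x z) λ r → (IsPath q → IsPath r) × (∀ {v} → v ∈ verts r → v ∈ verts q)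
  dropUntil {x} (nil _) (here refl) = nil _ , (λ u → u) , (λ v∈ → v∈)
  dropUntil {x} (cons {x = y} e q) x∈ with x ≟ y | x∈
  ... | yes refl | _          = cons e q , (λ u → u) , (λ v∈ → v∈)
  ... | no x≢y   | here x≡y   = ⊥-elim (x≢y x≡y)
  ... | no _     | there x∈′ with dropUntil q x∈′
  ...   | r , path , r⊆q = r , (λ { (_ ∷ u) → path u }) , (λ v∈ → there (r⊆q v∈))

  shortcut : ∀ {x y} (p : Walk G x y) → Σ (Walk G x y) λ q → IsPath q × (∀ {v} → v ∈ verts q → v ∈ verts p)
  shortcut (nil x) = nil x , [] ∷ [] , (λ v∈ → v∈)
  shortcut (cons {x = x} e p) with shortcut p
  ... | q , q-path , q⊆p with x ∈? verts q
  ...   | yes x∈ = let (r , r-path , r⊆q) = dropUntil q x∈ in r , r-path q-path , (λ v∈ → there (q⊆p (r⊆q v∈)))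
  ...   | no x∉  = cons e q , (¬Any⇒All¬ _ x∉ ∷ q-path) , λ { (here v≡) → here v≡ ; (there v∈) → there (q⊆p v∈) }

  cycle-through : ∀ {a b c} → Adj G a b → Adj G a c → b ≢ c → (p : Walk G b c) → a ∉ verts p → HasCycle G
  cycle-through {a} {b} {c} ab ac b≢c p a∉ with shortcut p
  ... | nil _ , _ , _ = ⊥-elim (b≢c refl)
  ... | cons e q , q-path , q⊆p =
    a , c , cons ab (cons e q) , (¬Any⇒All¬ _ (λ a∈ → a∉ (q⊆p a∈)) ∷ q-path) , s≤s (s≤s z≤n) , sym G ac

  module _ (tree : IsTree G) where

    adj? : ∀ a b → Dec (Adj G a b)
    adj? a b with shortcut (proj₁ tree a b)
    ... | nil _ , _ , _                      = no (irrefl G)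
    ... | cons e (nil _) , _ , _             = yes e
    ... | cons e (cons e′ r) , r-path , _ =
      no λ ab → proj₂ tree (a , b , cons e (cons e′ r) , r-path , s≤s (s≤s z≤n) , sym G ab)

    path-weight-unique : ∀ (w : V → V → ℚ) {a b} (p q : Walk G a b) → IsPath p → IsPath q →
      weight w p ≡ weight w q
    path-weight-unique w (nil a) (nil .a) _ _ = refl
    path-weight-unique w (nil a) (cons e q) _ q-path with closedPath⇒walkLength≡0 (cons e q) q-path
    ... | ()
    path-weight-unique w (cons e p) (nil _) p-path _ with closedPath⇒walkLength≡0 (cons e p) p-path
    ... | ()
    path-weight-unique w (cons {x = a} {y = b} e p) (cons {y = b′} e′ q) (a∉p ∷ p-path) (a∉q ∷ q-path)
      with b ≟ b′
    ... | yes refl = cong (w a b +_) (path-weight-unique w p q p-path q-path)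
    ... | no b≢b′  = ⊥-elim (proj₂ tree (cycle-through e e′ b≢b′ (p ++ʷ reverseʷ q) a∉))
      where
      a∉ : a ∉ verts (p ++ʷ reverseʷ q)
      a∉ a∈ = [ All¬⇒¬Any a∉p , (λ a∈′ → All¬⇒¬Any a∉q (∈-verts-reverseʷ⁻ q a∈′)) ]′
                (∈-verts-++ʷ⁻ p (reverseʷ q) a∈)

leaf? : ∀ {m} {T : Graph (Fin m)} → IsTree T → ∀ t → Dec (IsLeaf T t)
leaf? tree t = Finₚ.all? λ a → Finₚ.all? λ b →
  adj? Fin._≟_ tree t a →-dec (adj? Fin._≟_ tree t b →-dec (a Fin.≟ b))

ShortPath : ∀ {V} (T : Graph V) → (V → V → ℚ) → V → V → Set
ShortPath T w s t = Σ (Walk T s t) λ p → IsPath p × (weight w p ≤ 1ℚ)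

ShortPath-reverse : ∀ {V} {T : Graph V} {w : V → V → ℚ} → (∀ a b → w a b ≡ w b a) →
  ∀ {s t} → ShortPath T w s t ⇔ ShortPath T w t s
ShortPath-reverse {T = T} {w} w-sym = mk⇔ reverse reverse
  where
  reverse : ∀ {s t} → ShortPath T w s t → ShortPath T w t s
  reverse (p , p-path , short) =
    reverseʷ p , reverseʷ-isPath p p-path , subst (_≤ 1ℚ) (≡.sym (weight-reverseʷ w w-sym p)) short

-- A leaf root of G[S] in which T may still have leaves that are not labelled by S.
record LeafModel {n} (G : Graph (Fin n)) (S : Fin n → Set) (V : Set) : Set₁ where
  field
    T           : Graph V
    tree        : IsTree T
    ι           : Fin n → V
    ι-injective : ∀ x y → S x → S y → ι x ≡ ι y → x ≡ y
    ι-leaf      : ∀ x → S x → IsLeaf T (ι x)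
    w           : V → V → ℚ
    w-sym       : ∀ a b → w a b ≡ w b a
    w-bounded   : ∀ a b → Adj T a b → (0ℚ ≤ w a b) × (w a b ≤ 1ℚ)
    adjacency   : ∀ x y → S x → S y → x ≢ y → Adj G x y ⇔ ShortPath T w (ι x) (ι y)

LeavesLabelled : ∀ {n} {G : Graph (Fin n)} {S V} → LeafModel G S V → Set
LeavesLabelled {n} {S = S} M = ∀ t → IsLeaf T t → Σ (Fin n) λ x → S x × ι x ≡ t
  where open LeafModel M

LeafRoot : ∀ {n} → Graph (Fin n) → (Fin n → Set) → Set → Set₁
LeafRoot G S V = Σ (LeafModel G S V) LeavesLabelled

leafPowerIn⇒LeafRoot : ∀ {n} {G : Graph (Fin n)} {S} → LeafPowerIn G S → Σ ℕ λ m → LeafRoot G S (Fin m)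
leafPowerIn⇒LeafRoot (m , T , tree , ι , ι-inj , ι-leaf , labelled , w , w-sym , w-bdd , adj) =
  m , record { T = T ; tree = tree ; ι = ι ; ι-injective = ι-inj ; ι-leaf = ι-leaf
             ; w = w ; w-sym = w-sym ; w-bounded = w-bdd ; adjacency = adj } , labelled

leafRoot⇒LeafPowerIn : ∀ {n} {G : Graph (Fin n)} {S} {m} → LeafRoot G S (Fin m) → LeafPowerIn G S
leafRoot⇒LeafPowerIn {m = m} (M , labelled) =
  m , T , tree , ι , ι-injective , ι-leaf , labelled , w , w-sym , w-bounded , adjacency
  where open LeafModel M

LeafModel-⊆ : ∀ {n} {G : Graph (Fin n)} {S S′ : Fin n → Set} {V} →
  (∀ v → S′ v → S v) → LeafModel G S V → LeafModel G S′ V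
LeafModel-⊆ S′⊆S M = record
  { T = T ; tree = tree ; ι = ι
  ; ι-injective = λ x y x∈ y∈ → ι-injective x y (S′⊆S x x∈) (S′⊆S y y∈)
  ; ι-leaf = λ x x∈ → ι-leaf x (S′⊆S x x∈)
  ; w = w ; w-sym = w-sym ; w-bounded = w-bounded
  ; adjacency = λ x y x∈ y∈ → adjacency x y (S′⊆S x x∈) (S′⊆S y y∈) }
  where open LeafModel M

LeafRoot-cong : ∀ {n} {G : Graph (Fin n)} {S S′ : Fin n → Set} {V} →
  (∀ v → S v → S′ v) → (∀ v → S′ v → S v) → LeafRoot G S V → LeafRoot G S′ V
LeafRoot-cong S⊆S′ S′⊆S (M , labelled) =
  LeafModel-⊆ S′⊆S M , λ t t-leaf → let (x , x∈ , ιx≡t) = labelled t t-leaf in x , S⊆S′ x x∈ , ιx≡t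

LeafRoot-member? : ∀ {n} {G : Graph (Fin n)} {S} {m} → LeafRoot G S (Fin m) → ∀ x → Dec (S x)
LeafRoot-member? {S = S} (M , labelled) = member?
  where
  open LeafModel M
  member? : ∀ x → Dec (S x)
  member? x with leaf? tree (ι x)
  ... | no ¬leaf = no λ x∈ → ¬leaf (ι-leaf x x∈)
  ... | yes leaf with labelled (ι x) leaf
  ...   | x′ , x′∈ , ιx′≡ιx with x′ Fin.≟ x
  ...     | yes refl = yes x′∈
  ...     | no x′≢x  = no λ x∈ → x′≢x (ι-injective x′ x x′∈ x∈ ιx′≡ιx)

module Restrict {n} {G : Graph (Fin n)} {S : Fin n → Set} {V U : Set} (M : LeafModel G S V)
  (h : U → V) (h-inj : ∀ {i j} → h i ≡ h j → i ≡ j)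
  (connected : ∀ i j → Σ (Walk (LeafModel.T M) (h i) (h j)) λ p → All (InImage h) (verts p))
  (ι′ : Fin n → U) (h∘ι′ : ∀ x → S x → h (ι′ x) ≡ LeafModel.ι M x)
  (paths-in-image : ∀ x y → S x → S y → (p : Walk (LeafModel.T M) (LeafModel.ι M x) (LeafModel.ι M y)) →
                    IsPath p → All (InImage h) (verts p))
  where

  open LeafModel M

  private
    ι′-adjacency : ∀ x y → S x → S y → x ≢ y →
      Adj G x y ⇔ ShortPath (comap h T) (λ i j → w (h i) (h j)) (ι′ x) (ι′ y)
    ι′-adjacency x y x∈ y∈ x≢y = mk⇔ lift lower
      where
      lift : Adj G x y → ShortPath (comap h T) (λ i j → w (h i) (h j)) (ι′ x) (ι′ y)
      lift xy with to (adjacency x y x∈ y∈ x≢y) xy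
      ... | p , p-path , short
        with liftʷ T h h-inj p (paths-in-image x y x∈ y∈ p p-path) (ι′ x) (ι′ y) (h∘ι′ x x∈) (h∘ι′ y y∈)
      ...   | q , verts≡ , weight≡ =
        q , Uniqueₚ.map⁻ (subst Unique (≡.sym verts≡) p-path) , subst (_≤ 1ℚ) (≡.sym (weight≡ w)) short
      lower : ShortPath (comap h T) (λ i j → w (h i) (h j)) (ι′ x) (ι′ y) → Adj G x y
      lower (q , q-path , short) with castʷ (h∘ι′ x x∈) (h∘ι′ y y∈) (mapʷ {K = T} h (λ e → e) q)
      ... | p , verts≡ , weight≡ = from (adjacency x y x∈ y∈ x≢y)
        (p , subst Unique (≡.sym verts≡) (mapʷ-isPath {K = T} h (λ e → e) h-inj q q-path) ,
         subst (_≤ 1ℚ) (≡.sym (≡.trans (weight≡ w) (weight-mapʷ {K = T} h (λ e → e) w q))) short)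

  model : LeafModel G S U
  model = record
    { T = comap h T
    ; tree = comap-isTree T h h-inj tree connected
    ; ι = ι′
    ; ι-injective = λ x y x∈ y∈ ι′≡ → ι-injective x y x∈ y∈
        (≡.trans (≡.sym (h∘ι′ x x∈)) (≡.trans (cong h ι′≡) (h∘ι′ y y∈)))
    ; ι-leaf = λ x x∈ a b xa xb → h-inj (ι-leaf x x∈ (h a) (h b)
        (subst (λ z → Adj T z (h a)) (h∘ι′ x x∈) xa) (subst (λ z → Adj T z (h b)) (h∘ι′ x x∈) xb))
    ; w = λ i j → w (h i) (h j)
    ; w-sym = λ i j → w-sym (h i) (h j)
    ; w-bounded = λ i j → w-bounded (h i) (h j)
    ; adjacency = ι′-adjacency
    }

  model-labelled : (∀ v → InImage h v) → LeavesLabelled M → LeavesLabelled model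
  model-labelled surjective labelled t t-leaf with labelled (h t) h[t]-leaf
    where
    h[t]-leaf : IsLeaf T (h t)
    h[t]-leaf c d tc td with surjective c | surjective d
    ... | i , refl | j , refl = cong h (t-leaf i j tc td)
  ... | x , x∈ , ιx≡ht = x , x∈ , h-inj (≡.trans (h∘ι′ x x∈) ιx≡ht)

relabel : ∀ {n} {G : Graph (Fin n)} {S} {V} {m} → Fin m ↔ V → LeafRoot G S V → LeafRoot G S (Fin m)
relabel {S = S} Fin↔V (M , labelled) =
  R.model , R.model-labelled (λ v → index v , vertex∘index v) labelled
  where
  open Inverse Fin↔V using () renaming (to to vertex; from to index; strictlyInverseˡ to vertex∘index)
  open LeafModel M using (T; tree; ι)
  vertex-injective : ∀ {i j} → vertex i ≡ vertex j → i ≡ j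
  vertex-injective = Injection.injective (↔⇒↣ Fin↔V)
  everywhere : ∀ {a b} (p : Walk T a b) → All (InImage vertex) (verts p)
  everywhere p = All.tabulate λ {v} _ → index v , vertex∘index v
  connected : ∀ i j → Σ (Walk T (vertex i) (vertex j)) λ p → All (InImage vertex) (verts p)
  connected i j = proj₁ tree (vertex i) (vertex j) , everywhere (proj₁ tree (vertex i) (vertex j))
  index∘ι : Fin _ → Fin _
  index∘ι x = index (ι x)
  vertex∘index∘ι : ∀ x → S x → vertex (index∘ι x) ≡ ι x
  vertex∘index∘ι x _ = vertex∘index (ι x)
  paths-everywhere : ∀ x y → S x → S y → (p : Walk T (ι x) (ι y)) → IsPath p → All (InImage vertex) (verts p)
  paths-everywhere _ _ _ _ p _ = everywhere p
  module R = Restrict M vertex vertex-injective connected index∘ι vertex∘index∘ι paths-everywhere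

Separated : ∀ {n} {G : Graph (Fin n)} {S V} → LeafModel G S V → Set
Separated {S = S} M = ∀ x y → S x → S y → x ≢ y → (p : Walk T (ι x) (ι y)) → IsPath p → ⅔ ≤ weight w p
  where open LeafModel M

-- The new weight of an edge is the mean of its old weight and the leaf indicators of its ends, so a
-- leaf-to-leaf path of weight W gets weight (W + 2)/3: at most 1 iff W ≤ 1, and at least 2/3.
module Separate {n} {G : Graph (Fin n)} {S} {m} (M : LeafModel G S (Fin m)) where
  open LeafModel M

  isLeaf : Fin m → ℚ
  isLeaf v with leaf? tree v
  ... | yes _ = 1ℚ
  ... | no _  = 0ℚ

  isLeaf-leaf : ∀ v → IsLeaf T v → isLeaf v ≡ 1ℚ
  isLeaf-leaf v leaf with leaf? tree v
  ... | yes _    = refl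
  ... | no ¬leaf = ⊥-elim (¬leaf leaf)

  isLeaf-nonLeaf : ∀ v → ¬ IsLeaf T v → isLeaf v ≡ 0ℚ
  isLeaf-nonLeaf v ¬leaf with leaf? tree v
  ... | yes leaf = ⊥-elim (¬leaf leaf)
  ... | no _     = refl

  isLeaf-bounded : ∀ v → (0ℚ ≤ isLeaf v) × (isLeaf v ≤ 1ℚ)
  isLeaf-bounded v with leaf? tree v
  ... | yes _ = toWitness {a? = 0ℚ ℚ.≤? 1ℚ} _ , ℚₚ.≤-refl
  ... | no _  = ℚₚ.≤-refl , toWitness {a? = 0ℚ ℚ.≤? 1ℚ} _

  w′ : Fin m → Fin m → ℚ
  w′ a b = avg₃ (w a b) (isLeaf a) (isLeaf b)

  weight-w′ : ∀ {a b} (p : Walk T a b) → IsPath p → 1 ℕ.≤ walkLength p →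
    weight w′ p ≡ avg₃ (weight w p) (isLeaf a) (isLeaf b)
  weight-w′ (cons {x = a} {y = b} e (nil _)) _ _ =
    solve 3 (λ x i j → (x :+ (i :+ j)) :* con ⅓ :+ con 0ℚ := (x :+ con 0ℚ :+ (i :+ j)) :* con ⅓) refl
      (w a b) (isLeaf a) (isLeaf b)
    where open +-*-Solver
  weight-w′ (cons {x = a} {y = b} e (cons {y = c} e′ p)) (a∉ ∷ u) _
    rewrite weight-w′ (cons e′ p) u (s≤s z≤n) | isLeaf-nonLeaf b (path-interior-not-leaf e e′ p (a∉ ∷ u)) =
    solve 4 (λ x W i j → (x :+ (i :+ con 0ℚ)) :* con ⅓ :+ (W :+ (con 0ℚ :+ j)) :* con ⅓
                       := (x :+ W :+ (i :+ j)) :* con ⅓) refl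
      (w a b) (weight w (cons e′ p)) (isLeaf a) (isLeaf _)
    where open +-*-Solver

  weight-w′-between-labels : ∀ x y → S x → S y → x ≢ y → (p : Walk T (ι x) (ι y)) → IsPath p →
    weight w′ p ≡ avg₃ (weight w p) 1ℚ 1ℚ
  weight-w′-between-labels x y x∈ y∈ x≢y p p-path
    rewrite weight-w′ p p-path (≢⇒1≤walkLength (λ ιx≡ιy → x≢y (ι-injective x y x∈ y∈ ιx≡ιy)) p)
          | isLeaf-leaf (ι x) (ι-leaf x x∈) | isLeaf-leaf (ι y) (ι-leaf y y∈) = refl

  model : LeafModel G S (Fin m)
  model = record
    { T = T ; tree = tree ; ι = ι ; ι-injective = ι-injective ; ι-leaf = ι-leaf
    ; w = w′
    ; w-sym = λ a b → cong₂ (λ s t → (s + t) * ⅓) (w-sym a b) (ℚₚ.+-comm (isLeaf a) (isLeaf b))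
    ; w-bounded = λ a b ab →
        avg₃-mono-≤ (proj₁ (w-bounded a b ab)) (proj₁ (isLeaf-bounded a)) (proj₁ (isLeaf-bounded b)) ,
        avg₃-mono-≤ {y′ = 1ℚ} {z′ = 1ℚ}
          (proj₂ (w-bounded a b ab)) (proj₂ (isLeaf-bounded a)) (proj₂ (isLeaf-bounded b))
    ; adjacency = λ x y x∈ y∈ x≢y → mk⇔
        (λ xy → let (p , p-path , short) = to (adjacency x y x∈ y∈ x≢y) xy in
          p , p-path , subst (_≤ 1ℚ) (≡.sym (weight-w′-between-labels x y x∈ y∈ x≢y p p-path)) (to avg₃-≤1 short))
        (λ { (p , p-path , short) → from (adjacency x y x∈ y∈ x≢y)
          (p , p-path , from avg₃-≤1 (subst (_≤ 1ℚ) (weight-w′-between-labels x y x∈ y∈ x≢y p p-path) short)) })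
    }

  model-separated : Separated model
  model-separated x y x∈ y∈ x≢y p p-path =
    subst (⅔ ≤_) (≡.sym (weight-w′-between-labels x y x∈ y∈ x≢y p p-path))
      (avg₃-mono-≤ {y = 1ℚ} {z = 1ℚ} (weight-nonneg w (λ a b ab → proj₁ (w-bounded a b ab)) p) ℚₚ.≤-refl ℚₚ.≤-refl)

-- Gluing the leaf roots of the blocks

module Bridge {V₁ V₂ : Set} (T₁ : Graph V₁) (T₂ : Graph V₂) (a : V₁) (b : V₂) where

  Adjᴮ : V₁ ⊎ V₂ → V₁ ⊎ V₂ → Set
  Adjᴮ (inj₁ x) (inj₁ y) = Adj T₁ x y
  Adjᴮ (inj₂ x) (inj₂ y) = Adj T₂ x y
  Adjᴮ (inj₁ x) (inj₂ y) = (x ≡ a) × (y ≡ b)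
  Adjᴮ (inj₂ y) (inj₁ x) = (x ≡ a) × (y ≡ b)

  graph : Graph (V₁ ⊎ V₂)
  graph = record { Adj = Adjᴮ ; sym = λ {x} {y} → symᴮ x y ; irrefl = λ {x} → irreflᴮ x }
    where
    symᴮ : ∀ x y → Adjᴮ x y → Adjᴮ y x
    symᴮ (inj₁ x) (inj₁ y) xy = sym T₁ xy
    symᴮ (inj₂ x) (inj₂ y) xy = sym T₂ xy
    symᴮ (inj₁ x) (inj₂ y) xy = xy
    symᴮ (inj₂ x) (inj₁ y) xy = xy
    irreflᴮ : ∀ x → ¬ Adjᴮ x x
    irreflᴮ (inj₁ x) = irrefl T₁
    irreflᴮ (inj₂ x) = irrefl T₂

  inj₁ʷ : ∀ {x y} → Walk T₁ x y → Walk graph (inj₁ x) (inj₁ y)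
  inj₁ʷ = mapʷ inj₁ (λ e → e)

  inj₂ʷ : ∀ {x y} → Walk T₂ x y → Walk graph (inj₂ x) (inj₂ y)
  inj₂ʷ = mapʷ inj₂ (λ e → e)

  across : ∀ {x y} → Walk T₁ x a → Walk T₂ b y → Walk graph (inj₁ x) (inj₂ y)
  across (nil _)    q₂ = cons (refl , refl) (inj₂ʷ q₂)
  across (cons e q₁) q₂ = cons e (across q₁ q₂)

  verts-across : ∀ {x y} (q₁ : Walk T₁ x a) (q₂ : Walk T₂ b y) →
    verts (across q₁ q₂) ≡ map inj₁ (verts q₁) List.++ map inj₂ (verts q₂)
  verts-across (nil _)     q₂ = cong (inj₁ a ∷_) (verts-mapʷ inj₂ (λ e → e) q₂)
  verts-across (cons e q₁) q₂ = cong (_ ∷_) (verts-across q₁ q₂)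

  walkLength-across : ∀ {x y} (q₁ : Walk T₁ x a) (q₂ : Walk T₂ b y) →
    walkLength (across q₁ q₂) ≡ walkLength q₁ ℕ.+ suc (walkLength q₂)
  walkLength-across (nil _)     q₂ = cong suc (walkLength-mapʷ inj₂ (λ e → e) q₂)
  walkLength-across (cons e q₁) q₂ = cong suc (walkLength-across q₁ q₂)

  across-isPath : ∀ {x y} (q₁ : Walk T₁ x a) (q₂ : Walk T₂ b y) → IsPath q₁ → IsPath q₂ →
    IsPath (across q₁ q₂)
  across-isPath q₁ q₂ u₁ u₂ rewrite verts-across q₁ q₂ =
    Uniqueₚ.++⁺ (Uniqueₚ.map⁺ inj₁-injective u₁) (Uniqueₚ.map⁺ inj₂-injective u₂) λ (v∈₁ , v∈₂) →
      inj₁≢inj₂ (proj₂ (proj₂ (∈-map⁻ inj₁ v∈₁))) (proj₂ (proj₂ (∈-map⁻ inj₂ v∈₂)))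
    where
    inj₁≢inj₂ : ∀ {v} {x : V₁} {y : V₂} → v ≡ inj₁ x → v ≢ inj₂ y
    inj₁≢inj₂ refl ()

  across-isPath⁻ : ∀ {x y} (q₁ : Walk T₁ x a) (q₂ : Walk T₂ b y) → IsPath (across q₁ q₂) →
    IsPath q₁ × IsPath q₂
  across-isPath⁻ q₁ q₂ u with Unique-++⁻ (map inj₁ (verts q₁)) (subst Unique (verts-across q₁ q₂) u)
  ... | u₁ , u₂ = Uniqueₚ.map⁻ u₁ , Uniqueₚ.map⁻ u₂

  enters₁ : ∀ {z y} (p : Walk graph (inj₂ z) (inj₁ y)) → inj₁ a ∈ verts p
  enters₁ (cons {y = inj₂ _} e p)             = there (enters₁ p)
  enters₁ (cons {y = inj₁ _} (refl , refl) p) = there (head∈verts p)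

  enters₂ : ∀ {z y} (p : Walk graph (inj₁ z) (inj₂ y)) → inj₂ b ∈ verts p
  enters₂ (cons {y = inj₁ _} e p)             = there (enters₂ p)
  enters₂ (cons {y = inj₂ _} (refl , refl) p) = there (head∈verts p)

  inj₁-path⁻ : ∀ {x y} (p : Walk graph (inj₁ x) (inj₁ y)) → IsPath p → Σ (Walk T₁ x y) λ q → p ≡ inj₁ʷ q
  inj₁-path⁻ (nil _) _ = nil _ , refl
  inj₁-path⁻ (cons {y = inj₁ _} e p) (_ ∷ u) with inj₁-path⁻ p u
  ... | q , refl = cons e q , refl
  inj₁-path⁻ (cons {y = inj₂ _} (refl , refl) p) (a∉ ∷ _) = ⊥-elim (All¬⇒¬Any a∉ (enters₁ p))

  inj₂-path⁻ : ∀ {x y} (p : Walk graph (inj₂ x) (inj₂ y)) → IsPath p → Σ (Walk T₂ x y) λ q → p ≡ inj₂ʷ q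
  inj₂-path⁻ (nil _) _ = nil _ , refl
  inj₂-path⁻ (cons {y = inj₂ _} e p) (_ ∷ u) with inj₂-path⁻ p u
  ... | q , refl = cons e q , refl
  inj₂-path⁻ (cons {y = inj₁ _} (refl , refl) p) (b∉ ∷ _) = ⊥-elim (All¬⇒¬Any b∉ (enters₂ p))

  across⁻ : ∀ {x y} (p : Walk graph (inj₁ x) (inj₂ y)) → IsPath p →
    Σ (Walk T₁ x a) λ q₁ → Σ (Walk T₂ b y) λ q₂ → p ≡ across q₁ q₂
  across⁻ (cons {y = inj₁ _} e p) (_ ∷ u) with across⁻ p u
  ... | q₁ , q₂ , refl = cons e q₁ , q₂ , refl
  across⁻ (cons {y = inj₂ _} (refl , refl) p) (_ ∷ u) with inj₂-path⁻ p u
  ... | q₂ , refl = nil _ , q₂ , refl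

  isTree : IsTree T₁ → IsTree T₂ → IsTree graph
  isTree (connected₁ , acyclic₁) (connected₂ , acyclic₂) = connected , acyclic
    where
    connected : Connected graph
    connected (inj₁ x) (inj₁ y) = inj₁ʷ (connected₁ x y)
    connected (inj₂ x) (inj₂ y) = inj₂ʷ (connected₂ x y)
    connected (inj₁ x) (inj₂ y) = across (connected₁ x a) (connected₂ b y)
    connected (inj₂ x) (inj₁ y) = reverseʷ (across (connected₁ y a) (connected₂ b x))
    -- a path closed up by the bridge runs from a to b, so it is the bridge itself
    short-across : ∀ {x y} (p : Walk graph (inj₁ x) (inj₂ y)) → IsPath p → Adjᴮ (inj₂ y) (inj₁ x) →
      walkLength p ℕ.< 2
    short-across p u (refl , refl) with across⁻ p u
    ... | q₁ , q₂ , refl with across-isPath⁻ q₁ q₂ u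
    ...   | u₁ , u₂
      rewrite walkLength-across q₁ q₂ | closedPath⇒walkLength≡0 q₁ u₁ | closedPath⇒walkLength≡0 q₂ u₂ =
      s≤s (s≤s z≤n)
    acyclic : ¬ HasCycle graph
    acyclic (inj₁ x , inj₁ y , p , u , 2≤len , yx) with inj₁-path⁻ p u
    ... | q , refl = acyclic₁ (x , y , q , isPath-mapʷ⁻ inj₁ (λ e → e) q u ,
                                subst (2 ℕ.≤_) (walkLength-mapʷ inj₁ (λ e → e) q) 2≤len , yx)
    acyclic (inj₂ x , inj₂ y , p , u , 2≤len , yx) with inj₂-path⁻ p u
    ... | q , refl = acyclic₂ (x , y , q , isPath-mapʷ⁻ inj₂ (λ e → e) q u ,
                                subst (2 ℕ.≤_) (walkLength-mapʷ inj₂ (λ e → e) q) 2≤len , yx)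
    acyclic (inj₁ x , inj₂ y , p , u , 2≤len , yx) = ℕₚ.<⇒≱ (short-across p u yx) 2≤len
    acyclic (inj₂ x , inj₁ y , p , u , 2≤len , yx) =
      ℕₚ.<⇒≱ (short-across (reverseʷ p) (reverseʷ-isPath p u) yx)
             (subst (2 ℕ.≤_) (≡.sym (walkLength-reverseʷ p)) 2≤len)

  module Weighted (w₁ : V₁ → V₁ → ℚ) (w₂ : V₂ → V₂ → ℚ)
    (sym₁ : ∀ x y → w₁ x y ≡ w₁ y x) (sym₂ : ∀ x y → w₂ x y ≡ w₂ y x) where

    wᴮ : V₁ ⊎ V₂ → V₁ ⊎ V₂ → ℚ
    wᴮ (inj₁ x) (inj₁ y) = w₁ x y
    wᴮ (inj₂ x) (inj₂ y) = w₂ x y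
    wᴮ _        _        = 0ℚ

    wᴮ-sym : ∀ x y → wᴮ x y ≡ wᴮ y x
    wᴮ-sym (inj₁ x) (inj₁ y) = sym₁ x y
    wᴮ-sym (inj₂ x) (inj₂ y) = sym₂ x y
    wᴮ-sym (inj₁ x) (inj₂ y) = refl
    wᴮ-sym (inj₂ x) (inj₁ y) = refl

    wᴮ-bounded : (∀ x y → Adj T₁ x y → (0ℚ ≤ w₁ x y) × (w₁ x y ≤ 1ℚ)) →
                 (∀ x y → Adj T₂ x y → (0ℚ ≤ w₂ x y) × (w₂ x y ≤ 1ℚ)) →
                 ∀ x y → Adjᴮ x y → (0ℚ ≤ wᴮ x y) × (wᴮ x y ≤ 1ℚ)
    wᴮ-bounded bdd₁ bdd₂ (inj₁ x) (inj₁ y) xy = bdd₁ x y xy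
    wᴮ-bounded bdd₁ bdd₂ (inj₂ x) (inj₂ y) xy = bdd₂ x y xy
    wᴮ-bounded bdd₁ bdd₂ (inj₁ x) (inj₂ y) _  = ℚₚ.≤-refl , toWitness {a? = 0ℚ ℚ.≤? 1ℚ} _
    wᴮ-bounded bdd₁ bdd₂ (inj₂ x) (inj₁ y) _  = ℚₚ.≤-refl , toWitness {a? = 0ℚ ℚ.≤? 1ℚ} _

    weight-across : ∀ {x y} (q₁ : Walk T₁ x a) (q₂ : Walk T₂ b y) →
      weight wᴮ (across q₁ q₂) ≡ weight w₁ q₁ + weight w₂ q₂
    weight-across (nil _) q₂ = cong (0ℚ +_) (weight-mapʷ {K = graph} inj₂ (λ e → e) wᴮ q₂)
    weight-across (cons {x = x} {y = y} e q₁) q₂ =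
      ≡.trans (cong (w₁ x y +_) (weight-across q₁ q₂)) (≡.sym (ℚₚ.+-assoc (w₁ x y) _ _))

    weight-inj₁ʷ : ∀ {x y} (q : Walk T₁ x y) → weight wᴮ (inj₁ʷ q) ≡ weight w₁ q
    weight-inj₁ʷ = weight-mapʷ {K = graph} inj₁ (λ e → e) wᴮ

    weight-inj₂ʷ : ∀ {x y} (q : Walk T₂ x y) → weight wᴮ (inj₂ʷ q) ≡ weight w₂ q
    weight-inj₂ʷ = weight-mapʷ {K = graph} inj₂ (λ e → e) wᴮ

    ShortPath-inj₁ : ∀ {x y} → ShortPath T₁ w₁ x y ⇔ ShortPath graph wᴮ (inj₁ x) (inj₁ y)
    ShortPath-inj₁ = mk⇔ lift lower
      where
      lift : ∀ {x y} → ShortPath T₁ w₁ x y → ShortPath graph wᴮ (inj₁ x) (inj₁ y)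
      lift (q , q-path , short) =
        inj₁ʷ q , mapʷ-isPath inj₁ (λ e → e) inj₁-injective q q-path , subst (_≤ 1ℚ) (≡.sym (weight-inj₁ʷ q)) short
      lower : ∀ {x y} → ShortPath graph wᴮ (inj₁ x) (inj₁ y) → ShortPath T₁ w₁ x y
      lower (p , p-path , short) with inj₁-path⁻ p p-path
      ... | q , refl = q , isPath-mapʷ⁻ inj₁ (λ e → e) q p-path , subst (_≤ 1ℚ) (weight-inj₁ʷ q) short

    ShortPath-inj₂ : ∀ {x y} → ShortPath T₂ w₂ x y ⇔ ShortPath graph wᴮ (inj₂ x) (inj₂ y)
    ShortPath-inj₂ = mk⇔ lift lower
      where
      lift : ∀ {x y} → ShortPath T₂ w₂ x y → ShortPath graph wᴮ (inj₂ x) (inj₂ y)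
      lift (q , q-path , short) =
        inj₂ʷ q , mapʷ-isPath inj₂ (λ e → e) inj₂-injective q q-path , subst (_≤ 1ℚ) (≡.sym (weight-inj₂ʷ q)) short
      lower : ∀ {x y} → ShortPath graph wᴮ (inj₂ x) (inj₂ y) → ShortPath T₂ w₂ x y
      lower (p , p-path , short) with inj₂-path⁻ p p-path
      ... | q , refl = q , isPath-mapʷ⁻ inj₂ (λ e → e) q p-path , subst (_≤ 1ℚ) (weight-inj₂ʷ q) short

    ShortPath-across⁻ : ∀ {x y} → ShortPath graph wᴮ (inj₁ x) (inj₂ y) →
      Σ (Walk T₁ x a) λ q₁ → Σ (Walk T₂ b y) λ q₂ → (IsPath q₁ × IsPath q₂) × (weight w₁ q₁ + weight w₂ q₂ ≤ 1ℚ)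
    ShortPath-across⁻ (p , p-path , short) with across⁻ p p-path
    ... | q₁ , q₂ , refl =
      q₁ , q₂ , across-isPath⁻ q₁ q₂ p-path , subst (_≤ 1ℚ) (weight-across q₁ q₂) short

    ShortPath-to-b : ∀ {x} → ShortPath T₁ w₁ x a ⇔ ShortPath graph wᴮ (inj₁ x) (inj₂ b)
    ShortPath-to-b = mk⇔ lift lower
      where
      lift : ∀ {x} → ShortPath T₁ w₁ x a → ShortPath graph wᴮ (inj₁ x) (inj₂ b)
      lift (q , q-path , short) = across q (nil b) , across-isPath q (nil b) q-path ([] ∷ []) ,
        subst (_≤ 1ℚ) (≡.sym (≡.trans (weight-across q (nil b)) (ℚₚ.+-identityʳ _))) short
      lower : ∀ {x} → ShortPath graph wᴮ (inj₁ x) (inj₂ b) → ShortPath T₁ w₁ x a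
      lower P with ShortPath-across⁻ P
      ... | q₁ , q₂ , (q₁-path , q₂-path) , short =
        q₁ , q₁-path , subst (_≤ 1ℚ) (≡.trans (cong (weight w₁ q₁ +_) (closedPath⇒weight≡0 w₂ q₂ q₂-path))
                                              (ℚₚ.+-identityʳ _)) short

    ShortPath-from-a : ∀ {y} → ShortPath T₂ w₂ b y ⇔ ShortPath graph wᴮ (inj₁ a) (inj₂ y)
    ShortPath-from-a = mk⇔ lift lower
      where
      lift : ∀ {y} → ShortPath T₂ w₂ b y → ShortPath graph wᴮ (inj₁ a) (inj₂ y)
      lift (q , q-path , short) = across (nil a) q , across-isPath (nil a) q ([] ∷ []) q-path ,
        subst (_≤ 1ℚ) (≡.sym (≡.trans (weight-across (nil a) q) (ℚₚ.+-identityˡ _))) short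
      lower : ∀ {y} → ShortPath graph wᴮ (inj₁ a) (inj₂ y) → ShortPath T₂ w₂ b y
      lower P with ShortPath-across⁻ P
      ... | q₁ , q₂ , (q₁-path , q₂-path) , short =
        q₂ , q₂-path , subst (_≤ 1ℚ) (≡.trans (cong (_+ weight w₂ q₂) (closedPath⇒weight≡0 w₁ q₁ q₁-path))
                                              (ℚₚ.+-identityˡ _)) short

    ShortPath-to-a : ∀ {y} → ShortPath T₂ w₂ y b ⇔ ShortPath graph wᴮ (inj₂ y) (inj₁ a)
    ShortPath-to-a = ⇔.trans (ShortPath-reverse sym₂) (⇔.trans ShortPath-from-a (ShortPath-reverse wᴮ-sym))

K₁ : Graph (Fin 1)
K₁ = record { Adj = λ _ _ → ⊥ ; sym = λ () ; irrefl = λ () }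

K₁-isTree : IsTree K₁
K₁-isTree = (λ { Fin.zero Fin.zero → nil Fin.zero }) , λ { (_ , _ , _ , _ , _ , ()) }

adjacency-flip : ∀ {n} {G : Graph (Fin n)} {V} {T : Graph V} {w : V → V → ℚ} → (∀ a b → w a b ≡ w b a) →
  ∀ {x y s t} → Adj G x y ⇔ ShortPath T w s t → Adj G y x ⇔ ShortPath T w t s
adjacency-flip {G = G} w-sym xy⇔ =
  ⇔.trans (mk⇔ (sym G) (sym G)) (⇔.trans xy⇔ (ShortPath-reverse w-sym))

-- After separating both leaf roots, the old leaves of u are joined by an edge of weight 0 and the new
-- leaf of u hangs from u's old leaf in the first tree by another edge of weight 0; so a path to the new
-- leaf weighs what the path to an old leaf of u weighed.
module Glue {n} {G : Graph (Fin n)} {u : Fin n} {A B : Fin n → Set} {m₁ m₂}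
  (R₁ : LeafRoot G A (Fin m₁)) (R₂ : LeafRoot G B (Fin m₂)) (u∈A : A u) (u∈B : B u)
  (A∩B⊆u : ∀ x → A x → B x → x ≡ u) (no-edge : ∀ x y → A x → B y → x ≢ u → y ≢ u → ¬ Adj G x y)
  (c : Fin n) (c∈B : B c) (c≢u : c ≢ u) where

  module M₁ = LeafModel (Separate.model (proj₁ R₁))
  module M₂ = LeafModel (Separate.model (proj₁ R₂))

  a : Fin m₁
  a = M₁.ι u

  b : Fin m₂
  b = M₂.ι u

  module Inner  = Bridge M₁.T M₂.T a b
  module Innerʷ = Inner.Weighted M₁.w M₂.w M₁.w-sym M₂.w-sym
  module Outer  = Bridge Inner.graph K₁ (inj₁ a) Fin.zero
  module Outerʷ = Outer.Weighted Innerʷ.wᴮ (λ _ _ → 0ℚ) Innerʷ.wᴮ-sym (λ _ _ → refl)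

  V : Set
  V = (Fin m₁ ⊎ Fin m₂) ⊎ Fin 1

  z : V
  z = inj₂ Fin.zero

  data Side (x : Fin n) : Set where
    centre : x ≡ u → Side x
    left   : x ≢ u → A x → Side x
    right  : x ≢ u → ¬ A x → Side x

  side : ∀ x → Side x
  side x with x Fin.≟ u
  ... | yes x≡u = centre x≡u
  ... | no x≢u with LeafRoot-member? R₁ x
  ...   | yes x∈A = left x≢u x∈A
  ...   | no x∉A  = right x≢u x∉A

  ιˢ : ∀ {x} → Side x → V
  ιˢ         (centre _)  = z
  ιˢ {x} (left _ _)  = inj₁ (inj₁ (M₁.ι x))
  ιˢ {x} (right _ _) = inj₁ (inj₂ (M₂.ι x))

  ι : Fin n → V
  ι x = ιˢ (side x)

  ι-left : ∀ x → x ≢ u → A x → ι x ≡ inj₁ (inj₁ (M₁.ι x))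
  ι-left x x≢u x∈A with side x
  ... | centre x≡u  = ⊥-elim (x≢u x≡u)
  ... | left _ _    = refl
  ... | right _ x∉A = ⊥-elim (x∉A x∈A)

  ι-right : ∀ x → x ≢ u → B x → ι x ≡ inj₁ (inj₂ (M₂.ι x))
  ι-right x x≢u x∈B with side x
  ... | centre x≡u = ⊥-elim (x≢u x≡u)
  ... | left _ x∈A = ⊥-elim (x≢u (A∩B⊆u x x∈A x∈B))
  ... | right _ _  = refl

  S : Fin n → Set
  S x = A x ⊎ B x

  B-of-right : ∀ {x} → S x → ¬ A x → B x
  B-of-right (inj₁ x∈A) x∉A = ⊥-elim (x∉A x∈A)
  B-of-right (inj₂ x∈B) _   = x∈B

  ι-injective : ∀ x y → S x → S y → ι x ≡ ι y → x ≡ y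
  ι-injective x y x∈ y∈ ιx≡ιy with side x | side y
  ... | centre x≡u   | centre y≡u   = ≡.trans x≡u (≡.sym y≡u)
  ... | left _ x∈A   | left _ y∈A   = M₁.ι-injective x y x∈A y∈A (inj₁-injective (inj₁-injective ιx≡ιy))
  ... | right _ x∉A  | right _ y∉A  =
    M₂.ι-injective x y (B-of-right x∈ x∉A) (B-of-right y∈ y∉A) (inj₂-injective (inj₁-injective ιx≡ιy))
  ι-injective x y x∈ y∈ () | centre _ | left _ _
  ι-injective x y x∈ y∈ () | centre _ | right _ _
  ι-injective x y x∈ y∈ () | left _ _ | centre _
  ι-injective x y x∈ y∈ () | left _ _ | right _ _
  ι-injective x y x∈ y∈ () | right _ _ | centre _
  ι-injective x y x∈ y∈ () | right _ _ | left _ _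

  z-leaf : IsLeaf Outer.graph z
  z-leaf (inj₁ _) (inj₁ _) (refl , _) (refl , _) = refl

  left-leaf : ∀ v → v ≢ a → IsLeaf M₁.T v → IsLeaf Outer.graph (inj₁ (inj₁ v))
  left-leaf v v≢a v-leaf (inj₁ (inj₁ c)) (inj₁ (inj₁ d)) vc vd = cong (λ t → inj₁ (inj₁ t)) (v-leaf c d vc vd)
  left-leaf v v≢a v-leaf (inj₁ (inj₂ _)) _ (v≡a , _) _ = ⊥-elim (v≢a v≡a)
  left-leaf v v≢a v-leaf (inj₂ _)        _ (v≡a , _) _ = ⊥-elim (v≢a (inj₁-injective v≡a))
  left-leaf v v≢a v-leaf (inj₁ (inj₁ _)) (inj₁ (inj₂ _)) _ (v≡a , _) = ⊥-elim (v≢a v≡a)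
  left-leaf v v≢a v-leaf (inj₁ (inj₁ _)) (inj₂ _)        _ (v≡a , _) = ⊥-elim (v≢a (inj₁-injective v≡a))

  right-leaf : ∀ v → v ≢ b → IsLeaf M₂.T v → IsLeaf Outer.graph (inj₁ (inj₂ v))
  right-leaf v v≢b v-leaf (inj₁ (inj₂ c)) (inj₁ (inj₂ d)) vc vd = cong (λ t → inj₁ (inj₂ t)) (v-leaf c d vc vd)
  right-leaf v v≢b v-leaf (inj₁ (inj₁ _)) _ (_ , v≡b) _ = ⊥-elim (v≢b v≡b)
  right-leaf v v≢b v-leaf (inj₁ (inj₂ _)) (inj₁ (inj₁ _)) _ (_ , v≡b) = ⊥-elim (v≢b v≡b)

  ι-leaf : ∀ x → S x → IsLeaf Outer.graph (ι x)
  ι-leaf x x∈ with side x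
  ... | centre _    = z-leaf
  ... | left x≢u x∈A = left-leaf _ (λ ιx≡a → x≢u (M₁.ι-injective x u x∈A u∈A ιx≡a)) (M₁.ι-leaf x x∈A)
  ... | right x≢u x∉A = right-leaf _ (λ ιx≡b → x≢u (M₂.ι-injective x u x∈B u∈B ιx≡b)) (M₂.ι-leaf x x∈B)
    where x∈B = B-of-right x∈ x∉A

  b-neighbour : Σ (Fin m₂) (Adj M₂.T b)
  b-neighbour = first-step (λ b≡ιc → c≢u (M₂.ι-injective c u c∈B u∈B (≡.sym b≡ιc))) (proj₁ M₂.tree b (M₂.ι c))

  labelled : ∀ t → IsLeaf Outer.graph t → Σ (Fin n) λ x → S x × ι x ≡ t
  labelled (inj₂ Fin.zero) _ = u , inj₁ u∈A , ι-centre
    where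
    ι-centre : ι u ≡ z
    ι-centre with side u
    ... | centre _    = refl
    ... | left u≢u _  = ⊥-elim (u≢u refl)
    ... | right u≢u _ = ⊥-elim (u≢u refl)
  labelled (inj₁ (inj₁ v)) t-leaf with v Fin.≟ a
  ... | yes refl with t-leaf z (inj₁ (inj₂ b)) (refl , refl) (refl , refl)
  ...   | ()
  labelled (inj₁ (inj₁ v)) t-leaf | no v≢a
    with proj₂ R₁ v (λ c d vc vd → inj₁-injective (inj₁-injective (t-leaf (inj₁ (inj₁ c)) (inj₁ (inj₁ d)) vc vd)))
  ... | x , x∈A , ιx≡v = x , inj₁ x∈A ,
    ≡.trans (ι-left x (λ x≡u → v≢a (≡.trans (≡.sym ιx≡v) (cong M₁.ι x≡u))) x∈A) (cong (λ t → inj₁ (inj₁ t)) ιx≡v)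
  labelled (inj₁ (inj₂ v)) t-leaf with v Fin.≟ b
  ... | yes refl with b-neighbour
  ...   | d , bd with t-leaf (inj₁ (inj₁ a)) (inj₁ (inj₂ d)) (refl , refl) bd
  ...     | ()
  labelled (inj₁ (inj₂ v)) t-leaf | no v≢b
    with proj₂ R₂ v (λ c d vc vd → inj₂-injective (inj₁-injective (t-leaf (inj₁ (inj₂ c)) (inj₁ (inj₂ d)) vc vd)))
  ... | x , x∈B , ιx≡v = x , inj₂ x∈B ,
    ≡.trans (ι-right x (λ x≡u → v≢b (≡.trans (≡.sym ιx≡v) (cong M₂.ι x≡u))) x∈B) (cong (λ t → inj₁ (inj₂ t)) ιx≡v)

  w : V → V → ℚ
  w = Outerʷ.wᴮ

  w-sym : ∀ s t → w s t ≡ w t s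
  w-sym = Outerʷ.wᴮ-sym

  left-centre : ∀ x → x ≢ u → A x → Adj G x u ⇔ ShortPath Outer.graph w (inj₁ (inj₁ (M₁.ι x))) z
  left-centre x x≢u x∈A =
    ⇔.trans (M₁.adjacency x u x∈A u∈A x≢u) (⇔.trans Innerʷ.ShortPath-inj₁ Outerʷ.ShortPath-to-b)

  right-centre : ∀ x → x ≢ u → B x → Adj G x u ⇔ ShortPath Outer.graph w (inj₁ (inj₂ (M₂.ι x))) z
  right-centre x x≢u x∈B =
    ⇔.trans (M₂.adjacency x u x∈B u∈B x≢u) (⇔.trans Innerʷ.ShortPath-to-a Outerʷ.ShortPath-to-b)

  left-left : ∀ x y → A x → A y → x ≢ y →
    Adj G x y ⇔ ShortPath Outer.graph w (inj₁ (inj₁ (M₁.ι x))) (inj₁ (inj₁ (M₁.ι y)))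
  left-left x y x∈A y∈A x≢y =
    ⇔.trans (M₁.adjacency x y x∈A y∈A x≢y) (⇔.trans Innerʷ.ShortPath-inj₁ Outerʷ.ShortPath-inj₁)

  right-right : ∀ x y → B x → B y → x ≢ y →
    Adj G x y ⇔ ShortPath Outer.graph w (inj₁ (inj₂ (M₂.ι x))) (inj₁ (inj₂ (M₂.ι y)))
  right-right x y x∈B y∈B x≢y =
    ⇔.trans (M₂.adjacency x y x∈B y∈B x≢y) (⇔.trans Innerʷ.ShortPath-inj₂ Outerʷ.ShortPath-inj₁)

  left-right : ∀ x y → x ≢ u → A x → y ≢ u → B y →
    Adj G x y ⇔ ShortPath Outer.graph w (inj₁ (inj₁ (M₁.ι x))) (inj₁ (inj₂ (M₂.ι y)))
  left-right x y x≢u x∈A y≢u y∈B =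
    mk⇔ (λ xy → ⊥-elim (no-edge x y x∈A y∈B x≢u y≢u xy))
        (λ P → ⊥-elim (too-heavy (Innerʷ.ShortPath-across⁻ (from Outerʷ.ShortPath-inj₁ P))))
    where
    too-heavy : ¬ (Σ (Walk M₁.T (M₁.ι x) a) λ q₁ → Σ (Walk M₂.T b (M₂.ι y)) λ q₂ →
                   (IsPath q₁ × IsPath q₂) × (weight M₁.w q₁ + weight M₂.w q₂ ≤ 1ℚ))
    too-heavy (q₁ , q₂ , (q₁-path , q₂-path) , short) = ℚₚ.<-irrefl refl
      (ℚₚ.<-≤-trans (ℚₚ.<-≤-trans 1<⅔+⅔ (ℚₚ.+-mono-≤
         (Separate.model-separated (proj₁ R₁) x u x∈A u∈A x≢u q₁ q₁-path)
         (Separate.model-separated (proj₁ R₂) u y u∈B y∈B (λ u≡y → y≢u (≡.sym u≡y)) q₂ q₂-path))) short)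

  adjacency : ∀ x y → S x → S y → x ≢ y → Adj G x y ⇔ ShortPath Outer.graph w (ι x) (ι y)
  adjacency x y x∈ y∈ x≢y with side x | side y
  ... | centre refl    | centre refl    = ⊥-elim (x≢y refl)
  ... | left x≢u x∈A   | centre refl    = left-centre x x≢u x∈A
  ... | centre refl    | left y≢u y∈A   = adjacency-flip {G = G} w-sym (left-centre y y≢u y∈A)
  ... | right x≢u x∉A  | centre refl    = right-centre x x≢u (B-of-right x∈ x∉A)
  ... | centre refl    | right y≢u y∉A  = adjacency-flip {G = G} w-sym (right-centre y y≢u (B-of-right y∈ y∉A))
  ... | left _ x∈A     | left _ y∈A     = left-left x y x∈A y∈A x≢y
  ... | right _ x∉A    | right _ y∉A    = right-right x y (B-of-right x∈ x∉A) (B-of-right y∈ y∉A) x≢y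
  ... | left x≢u x∈A   | right y≢u y∉A  = left-right x y x≢u x∈A y≢u (B-of-right y∈ y∉A)
  ... | right x≢u x∉A  | left y≢u y∈A   =
    adjacency-flip {G = G} w-sym (left-right y x y≢u y∈A x≢u (B-of-right x∈ x∉A))

  model : LeafModel G S V
  model = record
    { T = Outer.graph
    ; tree = Outer.isTree (Inner.isTree M₁.tree M₂.tree) K₁-isTree
    ; ι = ι ; ι-injective = ι-injective ; ι-leaf = ι-leaf
    ; w = w ; w-sym = w-sym
    ; w-bounded = Outerʷ.wᴮ-bounded (Innerʷ.wᴮ-bounded M₁.w-bounded M₂.w-bounded) (λ _ _ ())
    ; adjacency = adjacency
    }

  result : LeafRoot G S (Fin ((m₁ ℕ.+ m₂) ℕ.+ 1))
  result = relabel ((Finₚ.+↔⊎ ⊎-↔ ↔-id (Fin 1)) ↔-∘ Finₚ.+↔⊎) (model , labelled)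

module _ {n} {G : Graph (Fin n)} {P : Fin n → Set} where

  ReachIn-trans : ∀ {x y z} → ReachIn G P x y → ReachIn G P y z → ReachIn G P x z
  ReachIn-trans (p , p⊆P) (q , q⊆P) =
    p ++ʷ q , All.tabulate λ v∈ → [ All.lookup p⊆P , All.lookup q⊆P ]′ (∈-verts-++ʷ⁻ p q v∈)

  ReachIn-sym : ∀ {x y} → ReachIn G P x y → ReachIn G P y x
  ReachIn-sym (p , p⊆P) = reverseʷ p , All.tabulate λ v∈ → All.lookup p⊆P (∈-verts-reverseʷ⁻ p v∈)

  ReachIn-step : ∀ {x y z} → ReachIn G P x y → Adj G y z → P z → ReachIn G P x z
  ReachIn-step (p , p⊆P) yz z∈P =
    ReachIn-trans (p , p⊆P) (cons yz (nil _) , All.lookup p⊆P (last∈verts p) ∷ z∈P ∷ [])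

module Assemble {n} (G : Graph (Fin n)) (u : Fin n)
  (component-leafPower : ∀ c → c ≢ u → LeafPowerIn G (CompPlus G u c)) where

  Covered : List (Fin n) → Fin n → Set
  Covered cs v = v ≡ u ⊎ Σ (Fin n) λ c → c ∈ cs × c ≢ u × ReachIn G (_≢ u) c v

  Covered-∷⁻ : ∀ {c cs v} → Covered (c ∷ cs) v → Covered cs v ⊎ CompPlus G u c v
  Covered-∷⁻ (inj₁ v≡u) = inj₁ (inj₁ v≡u)
  Covered-∷⁻ (inj₂ (_ , here refl , _ , reach))    = inj₂ (inj₂ reach)
  Covered-∷⁻ (inj₂ (c′ , there c′∈ , c′≢u , reach)) = inj₁ (inj₂ (c′ , c′∈ , c′≢u , reach))

  Covered-weaken : ∀ {c cs v} → Covered cs v → Covered (c ∷ cs) v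
  Covered-weaken (inj₁ v≡u)                    = inj₁ v≡u
  Covered-weaken (inj₂ (c′ , c′∈ , c′≢u , reach)) = inj₂ (c′ , there c′∈ , c′≢u , reach)

  covered-none : LeafRoot G (Covered []) (Fin 1)
  covered-none =
    record { T = K₁ ; tree = K₁-isTree ; ι = λ _ → Fin.zero
           ; ι-injective = λ { x y (inj₁ refl) (inj₁ refl) _ → refl }
           ; ι-leaf = λ _ _ _ _ ()
           ; w = λ _ _ → 0ℚ ; w-sym = λ _ _ → refl ; w-bounded = λ _ _ ()
           ; adjacency = λ { x y (inj₁ refl) (inj₁ refl) x≢y → ⊥-elim (x≢y refl) } } ,
    λ { Fin.zero _ → u , inj₁ refl , refl }

  absorb : ∀ {c cs m} → (∀ v → CompPlus G u c v → Covered cs v) →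
    LeafRoot G (Covered cs) (Fin m) → LeafRoot G (Covered (c ∷ cs)) (Fin m)
  absorb absorbed = LeafRoot-cong (λ _ → Covered-weaken) (λ v v∈ → [ (λ v∈′ → v∈′) , absorbed v ]′ (Covered-∷⁻ v∈))

  add-component : ∀ {c cs m} → c ≢ u → ¬ Covered cs c →
    LeafRoot G (Covered cs) (Fin m) → Σ ℕ λ m′ → LeafRoot G (Covered (c ∷ cs)) (Fin m′)
  add-component {c} {cs} c≢u c∉ R =
    _ , LeafRoot-cong (λ _ → [ Covered-weaken , new ]′) (λ _ → Covered-∷⁻)
          (Glue.result R (proj₂ (leafPowerIn⇒LeafRoot (component-leafPower c c≢u))) (inj₁ refl) (inj₁ refl)
             disjoint no-edge c (inj₂ (nil c , c≢u ∷ [])) c≢u)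
    where
    new : ∀ {v} → CompPlus G u c v → Covered (c ∷ cs) v
    new (inj₁ v≡u)  = inj₁ v≡u
    new (inj₂ reach) = inj₂ (c , here refl , c≢u , reach)
    disjoint : ∀ x → Covered cs x → CompPlus G u c x → x ≡ u
    disjoint x (inj₁ x≡u) _ = x≡u
    disjoint x _ (inj₁ x≡u) = x≡u
    disjoint x (inj₂ (c′ , c′∈ , c′≢u , c′⇝x)) (inj₂ c⇝x) =
      ⊥-elim (c∉ (inj₂ (c′ , c′∈ , c′≢u , ReachIn-trans c′⇝x (ReachIn-sym c⇝x))))
    no-edge : ∀ x y → Covered cs x → CompPlus G u c y → x ≢ u → y ≢ u → ¬ Adj G x y
    no-edge x y x∈ (inj₁ y≡u) _ y≢u _ = y≢u y≡u
    no-edge x y x∈ (inj₂ c⇝y) x≢u _ xy = x≢u (disjoint x x∈ (inj₂ (ReachIn-step c⇝y (sym G xy) x≢u)))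

  covered : ∀ cs → Σ ℕ λ m → LeafRoot G (Covered cs) (Fin m)
  covered [] = 1 , covered-none
  covered (c ∷ cs) with covered cs
  ... | m , R with c Fin.≟ u
  ...   | yes refl = m , absorb (λ { v (inj₁ v≡u) → inj₁ v≡u
                                ; v (inj₂ (p , p⊆≢u)) → ⊥-elim (All.lookup p⊆≢u (head∈verts p) refl) }) R
  ...   | no c≢u with LeafRoot-member? R c
  ...     | yes (inj₁ c≡u) = ⊥-elim (c≢u c≡u)
  ...     | yes (inj₂ (c′ , c′∈ , c′≢u , c′⇝c)) =
    m , absorb (λ { v (inj₁ v≡u) → inj₁ v≡u ; v (inj₂ c⇝v) → inj₂ (c′ , c′∈ , c′≢u , ReachIn-trans c′⇝c c⇝v) }) R
  ...     | no c∉ = add-component c≢u c∉ R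

  leafPower : LeafPower G
  leafPower with covered (allFin n)
  ... | m , R = leafRoot⇒LeafPowerIn (LeafRoot-cong (λ _ _ → tt) (λ v _ → everything v) R)
    where
    everything : ∀ v → Covered (allFin n) v
    everything v with v Fin.≟ u
    ... | yes v≡u = inj₁ v≡u
    ... | no v≢u  = inj₂ (v , ∈-allFin v , v≢u , nil v , v≢u ∷ [])

-- Restricting a leaf root to a block

module _ {n} {G : Graph (Fin n)} {S} {m} (M : LeafModel G S (Fin m)) where
  open LeafModel M

  LeafModel-adjacent? : ∀ x y → S x → S y → Dec (Adj G x y)
  LeafModel-adjacent? x y x∈ y∈ with x Fin.≟ y
  ... | yes refl = no (irrefl G)
  ... | no x≢y with shortcut Fin._≟_ (proj₁ tree (ι x) (ι y))
  ...   | p , p-path , _ with weight w p ℚ.≤? 1ℚ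
  ...     | yes short = yes (from (adjacency x y x∈ y∈ x≢y) (p , p-path , short))
  ...     | no long = no λ xy → let (q , q-path , short) = to (adjacency x y x∈ y∈ x≢y) xy in
            long (subst (_≤ 1ℚ) (path-weight-unique Fin._≟_ tree w q p q-path p-path) short)

module _ {n} {G : Graph (Fin n)} (adj? : ∀ x y → Dec (Adj G x y)) {P : Fin n → Set} (P? : ∀ x → Dec (P x)) where

  ReachWithin : ℕ → Fin n → Fin n → Set
  ReachWithin k c v = Σ (Walk G c v) λ p → All P (verts p) × walkLength p ℕ.≤ k

  reachWithin? : ∀ k c v → Dec (ReachWithin k c v)
  reachWithin? zero c v = map′
    (λ { (refl , c∈P) → nil c , c∈P ∷ [] , z≤n })
    (λ { (nil _ , c∈P ∷ [] , _) → refl , c∈P ; (cons _ _ , _ , ()) })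
    (c Fin.≟ v ×-dec P? c)
  reachWithin? (suc k) c v = map′
    (λ { (inj₁ (refl , c∈P)) → nil c , c∈P ∷ [] , z≤n
       ; (inj₂ (_ , cd , c∈P , p , p⊆P , len)) → cons cd p , c∈P ∷ p⊆P , s≤s len })
    (λ { (nil _ , c∈P ∷ [] , _) → inj₁ (refl , c∈P)
       ; (cons cd p , c∈P ∷ p⊆P , s≤s len) → inj₂ (_ , cd , c∈P , p , p⊆P , len) })
    ((c Fin.≟ v ×-dec P? c) ⊎-dec Finₚ.any? λ d → adj? c d ×-dec (P? c ×-dec reachWithin? k d v))

  -- a walk shortcuts to a path, and a path in a graph on Fin n has fewer than n edges
  ReachIn? : ∀ c v → Dec (ReachIn G P c v)
  ReachIn? c v = map′ (λ (p , p⊆P , _) → p , p⊆P) within-n (reachWithin? n c v)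
    where
    within-n : ReachIn G P c v → ReachWithin n c v
    within-n (p , p⊆P) with shortcut Fin._≟_ p
    ... | q , q-path , q⊆p = q , All.tabulate (λ v∈ → All.lookup p⊆P (q⊆p v∈)) ,
      ℕₚ.≤-trans (ℕₚ.n≤1+n _) (subst (ℕ._≤ n) (length-verts q) (Unique⇒length≤ q-path))

module Prune {n} {G : Graph (Fin n)} {S : Fin n → Set} {m} (M : LeafModel G S (Fin (suc m)))
  (x₀ : Fin n) (x₀∈S : S x₀) (t : Fin (suc m)) (t-leaf : IsLeaf (LeafModel.T M) t)
  (t-unlabelled : ∀ x → S x → LeafModel.ι M x ≢ t) where

  open LeafModel M

  ≢t⇒InImage : ∀ {v} → v ≢ t → InImage (Fin.punchIn t) v
  ≢t⇒InImage v≢t = Fin.punchOut (λ t≡v → v≢t (≡.sym t≡v)) , Finₚ.punchIn-punchOut _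

  avoids-t : ∀ {a b} (p : Walk T a b) → IsPath p → t ≢ a → t ≢ b → All (InImage (Fin.punchIn t)) (verts p)
  avoids-t p p-path t≢a t≢b = All.map ≢t⇒InImage (leaf-avoided-by-path t-leaf p p-path t≢a t≢b)

  ι′ : Fin n → Fin m
  ι′ x with ι x Fin.≟ t
  ... | yes _  = proj₁ (≢t⇒InImage (t-unlabelled x₀ x₀∈S))
  ... | no ι≢t = proj₁ (≢t⇒InImage ι≢t)

  punchIn∘ι′ : ∀ x → S x → Fin.punchIn t (ι′ x) ≡ ι x
  punchIn∘ι′ x x∈ with ι x Fin.≟ t
  ... | yes ι≡t = ⊥-elim (t-unlabelled x x∈ ι≡t)
  ... | no ι≢t  = proj₂ (≢t⇒InImage ι≢t)

  model : LeafModel G S (Fin m)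
  model = Restrict.model M (Fin.punchIn t) (Finₚ.punchIn-injective t _ _)
    (λ i j → let (p , p-path , _) = shortcut Fin._≟_ (proj₁ tree (Fin.punchIn t i) (Fin.punchIn t j)) in
      p , avoids-t p p-path (λ t≡ → Finₚ.punchInᵢ≢i t i (≡.sym t≡)) (λ t≡ → Finₚ.punchInᵢ≢i t j (≡.sym t≡)))
    ι′ punchIn∘ι′
    (λ x y x∈ y∈ p p-path →
      avoids-t p p-path (λ t≡ → t-unlabelled x x∈ (≡.sym t≡)) (λ t≡ → t-unlabelled y y∈ (≡.sym t≡)))

trim : ∀ {n} {G : Graph (Fin n)} {S : Fin n → Set} → (∀ x → Dec (S x)) → ∀ x₀ → S x₀ →
  ∀ m → LeafModel G S (Fin m) → Σ ℕ λ m′ → LeafRoot G S (Fin m′)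
trim S? x₀ x₀∈S zero M with LeafModel.ι M x₀
... | ()
trim S? x₀ x₀∈S (suc m) M with Finₚ.any? (λ t → leaf? tree t ×-dec Finₚ.all? λ x → S? x →-dec ¬? (ι x Fin.≟ t))
  where open LeafModel M
... | yes (t , t-leaf , t-unlabelled) = trim S? x₀ x₀∈S m (Prune.model M x₀ x₀∈S t t-leaf t-unlabelled)
... | no no-unlabelled-leaf = suc m , M , labelled
  where
  open LeafModel M
  labelled : LeavesLabelled M
  labelled t t-leaf with Finₚ.any? (λ x → S? x ×-dec (ι x Fin.≟ t))
  ... | yes labelling = labelling
  ... | no unlabelled = ⊥-elim (no-unlabelled-leaf (t , t-leaf , λ x x∈ ιx≡t → unlabelled (x , x∈ , ιx≡t)))

leafPower⇒component : ∀ {n} (G : Graph (Fin n)) (u : Fin n) → LeafPower G →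
  ∀ c → LeafPowerIn G (CompPlus G u c)
leafPower⇒component G u G-leafPower c with leafPowerIn⇒LeafRoot {G = G} {S = λ _ → ⊤} G-leafPower
... | m , M , _ = leafRoot⇒LeafPowerIn (proj₂ (trim member? u (inj₁ refl) m (LeafModel-⊆ (λ _ _ → tt) M)))
  where
  adjacent? : ∀ x y → Dec (Adj G x y)
  adjacent? x y = LeafModel-adjacent? M x y tt tt
  member? : ∀ x → Dec (CompPlus G u c x)
  member? x = (x Fin.≟ u) ⊎-dec ReachIn? adjacent? (λ y → ¬? (y Fin.≟ u)) c x

-- Both directions hold for every vertex u.
lemma2 : ∀ {n} (G : Graph (Fin n)) (u : Fin n) → IsCutVertex G u →
    LeafPower G ⇔ (∀ c → c ≢ u → LeafPowerIn G (CompPlus G u c))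
lemma2 G u _ = mk⇔ (λ G-leafPower c _ → leafPower⇒component G u G-leafPower c) (Assemble.leafPower G u)
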